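{- For $i\in[t]$ and $j\in[d]$ let $u_{i,j}\in\mathbb{F}_2^k$ be independent uniformly random vectors, and consider the random $d$-linear form $p:(\mathbb{F}_2^k)^d\to\mathbb{F}_2$, $$p(x_1,\dots,x_d)=\sum_{i=1}^t\prod_{j=1}^d\langle x_j,u_{i,j}\rangle.$$ Then $\mathbb{E}[\mathrm{bias}(p)]\le d\cdot2^{ -k}+\left(1-\frac{2}{2^d}\right)^t.$
   Context: $\langle\cdot,\cdot\rangle$ is the standard inner product on $\mathbb{F}_2^k$, and $\mathrm{bias}(p)=\left|\mathbb{E}_{x_1,\dots,x_d\in\mathbb{F}_2^k}(-1)^{p(x_1,\dots,x_d)}\right|$. -}

module Defs where

open import Data.Bool using (Bool; true; false; _xor_; _∧_)
open import Data.Nat using (ℕ; zero; suc)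
open import Data.Integer using (ℤ; +_; -[1+_])
open import Data.List using (List; []; _∷_; map; concatMap; foldr; length)
open import Data.Vec using (Vec; []; _∷_; zipWith)
import Data.Vec as V
open import Data.Rational using (ℚ; 0ℚ; 1ℚ; _+_; _*_; _-_; ∣_∣; _/_)

-- Vectors in F₂^k, with F₂ represented by Bool (xor = +, ∧ = ·).
F₂^ : ℕ → Set
F₂^ k = Vec Bool k

⟨_,_⟩ : ∀ {k} → F₂^ k → F₂^ k → Bool
⟨ x , y ⟩ = V.foldr _ _xor_ false (zipWith _∧_ x y)

allVecsOf : ∀ {A : Set} → List A → (n : ℕ) → List (Vec A n)
allVecsOf xs zero = [] ∷ []
allVecsOf xs (suc n) = concatMap (λ a → map (a ∷_) (allVecsOf xs n)) xs

allF₂^ : (k : ℕ) → List (F₂^ k)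
allF₂^ k = allVecsOf (false ∷ true ∷ []) k

sumℚ : List ℚ → ℚ
sumℚ = foldr _+_ 0ℚ

𝔼 : ∀ {A : Set} → List A → (A → ℚ) → ℚ
𝔼 xs f with length xs
... | zero = 0ℚ
... | suc n = sumℚ (map f xs) * (+ 1 / suc n)

_^ℚ_ : ℚ → ℕ → ℚ
q ^ℚ zero = 1ℚ
q ^ℚ suc n = q * (q ^ℚ n)

sign : Bool → ℚ
sign false = 1ℚ
sign true = -[1+ 0 ] / 1

bias : ∀ {k d} → (Vec (F₂^ k) d → Bool) → ℚ
bias {k} {d} p = ∣ 𝔼 (allVecsOf (allF₂^ k) d) (λ x → sign (p x)) ∣

form : ∀ {k d t} → Vec (Vec (F₂^ k) d) t → Vec (F₂^ k) d → Bool
form u x = V.foldr _ _xor_ false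
  (V.map (λ ui → V.foldr _ _∧_ true (zipWith ⟨_,_⟩ x ui)) u)

allArrays : (k d t : ℕ) → List (Vec (Vec (F₂^ k) d) t)
allArrays k d t = allVecsOf (allVecsOf (allF₂^ k) d) t

½ : ℚ
½ = + 1 / 2

-- Averaging over u first, the rows u_i are
-- independent, so E_u (-1)^p(x) = (E_r (-1)^(∏_j ⟨x_j , r_j⟩))^t, and the inner
-- average is 1 - 2·2^-d when every x_j is nonzero and 1 otherwise. The absolute
-- value in bias(p) can be dropped: p is linear in x₁, so each average over x₁ of
-- (-1)^p is 0 or 1. Hence E_u bias(p) ≤ (1 - 2·2^-d)^t + Pr_x[some x_j = 0], and
-- the union bound gives Pr_x[some x_j = 0] ≤ d·2^-k.
module Submission where

open import Defs
open import Data.Nat using (ℕ; _≥_)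
open import Data.Integer using (+_)
open import Data.Rational using (ℚ; 1ℚ; _+_; _*_; _-_; _≤_; _/_)

open import Algebra using (CommutativeRing)
open import Data.Bool using (Bool; true; false; _xor_; _∧_; _∨_; not; if_then_else_)
open import Data.Bool.Properties using (∧-assoc; ∧-comm; ∧-distribˡ-xor; ∧-distribʳ-xor; xor-∧-commutativeRing)
open import Data.Nat using (zero; suc)
import Data.Nat.Properties as ℕ
open import Data.Nat.Coprimality using (1-coprimeTo) renaming (sym to coprime-sym)
import Data.Integer.Properties as ℤ
open import Data.List using (List; []; _∷_; map; concatMap; length; _++_)
open import Data.Vec as V using (Vec; []; _∷_; zipWith)
open import Data.Rational using (mkℚ; 0ℚ; _<_; ∣_∣; -_; positive; nonNegative)
open import Data.Rational.Properties
open import Data.Rational.Solver using (module +-*-Solver)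
open import Relation.Binary.PropositionalEquality
open import Function using (_∘_)
open import Relation.Nullary using (contradiction)

open +-*-Solver
open CommutativeRing xor-∧-commutativeRing using (+-commutativeSemigroup)
open import Algebra.Properties.CommutativeSemigroup +-commutativeSemigroup using (interchange)

-- Finite sums

private
  variable
    A B : Set

∑ : List A → (A → ℚ) → ℚ
∑ xs f = sumℚ (map f xs)

count : List A → ℚ
count xs = ∑ xs (λ _ → 1ℚ)

∑-cong : (xs : List A) {f g : A → ℚ} → (∀ a → f a ≡ g a) → ∑ xs f ≡ ∑ xs g
∑-cong [] e = refl
∑-cong (x ∷ xs) e = cong₂ _+_ (e x) (∑-cong xs e)

∑-++ : (xs ys : List A) (f : A → ℚ) → ∑ (xs ++ ys) f ≡ ∑ xs f + ∑ ys f
∑-++ [] ys f = sym (+-identityˡ _)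
∑-++ (x ∷ xs) ys f = trans (cong (_+_ (f x)) (∑-++ xs ys f)) (sym (+-assoc (f x) _ _))

∑-*ˡ : (xs : List A) (c : ℚ) (f : A → ℚ) → ∑ xs (λ a → c * f a) ≡ c * ∑ xs f
∑-*ˡ [] c f = sym (*-zeroʳ c)
∑-*ˡ (x ∷ xs) c f = trans (cong (_+_ (c * f x)) (∑-*ˡ xs c f)) (sym (*-distribˡ-+ c _ _))

∑-*ʳ : (xs : List A) (c : ℚ) (f : A → ℚ) → ∑ xs (λ a → f a * c) ≡ ∑ xs f * c
∑-*ʳ xs c f = trans (∑-cong xs (λ a → *-comm (f a) c)) (trans (∑-*ˡ xs c f) (*-comm c _))

∑-const : (xs : List A) (c : ℚ) → ∑ xs (λ _ → c) ≡ c * count xs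
∑-const xs c = trans (∑-cong xs (λ _ → sym (*-identityʳ c))) (∑-*ˡ xs c (λ _ → 1ℚ))

∑-0 : (xs : List A) → ∑ xs (λ _ → 0ℚ) ≡ 0ℚ
∑-0 xs = trans (∑-const xs 0ℚ) (*-zeroˡ (count xs))

∑-+ : (xs : List A) (f g : A → ℚ) → ∑ xs (λ a → f a + g a) ≡ ∑ xs f + ∑ xs g
∑-+ [] f g = refl
∑-+ (x ∷ xs) f g = trans (cong (_+_ (f x + g x)) (∑-+ xs f g))
  (solve 4 (λ a b c d → (a :+ b) :+ (c :+ d) := (a :+ c) :+ (b :+ d)) refl (f x) (g x) (∑ xs f) (∑ xs g))

∑-neg : (xs : List A) (f : A → ℚ) → ∑ xs (λ a → - f a) ≡ - ∑ xs f
∑-neg [] f = refl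
∑-neg (x ∷ xs) f = trans (cong (_+_ (- f x)) (∑-neg xs f)) (sym (neg-distrib-+ (f x) _))

∑-comm : (xs : List A) (ys : List B) (f : A → B → ℚ) →
         ∑ xs (λ a → ∑ ys (f a)) ≡ ∑ ys (λ b → ∑ xs (λ a → f a b))
∑-comm [] ys f = sym (∑-0 ys)
∑-comm (x ∷ xs) ys f = trans (cong (_+_ (∑ ys (f x))) (∑-comm xs ys f)) (sym (∑-+ ys (f x) _))

∑-concatMap : (g : A → List B) (xs : List A) (f : B → ℚ) →
              ∑ (concatMap g xs) f ≡ ∑ xs (λ a → ∑ (g a) f)
∑-concatMap g [] f = refl
∑-concatMap g (x ∷ xs) f = trans (∑-++ (g x) _ f) (cong (_+_ (∑ (g x) f)) (∑-concatMap g xs f))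

∑-map : (h : B → A) (xs : List B) (f : A → ℚ) → ∑ (map h xs) f ≡ ∑ xs (f ∘ h)
∑-map h [] f = refl
∑-map h (x ∷ xs) f = cong (_+_ (f (h x))) (∑-map h xs f)

∑-mono-≤ : (xs : List A) {f g : A → ℚ} → (∀ a → f a ≤ g a) → ∑ xs f ≤ ∑ xs g
∑-mono-≤ [] e = ≤-refl
∑-mono-≤ (x ∷ xs) e = +-mono-≤ (e x) (∑-mono-≤ xs e)

∑-nonNeg : (xs : List A) {f : A → ℚ} → (∀ a → 0ℚ ≤ f a) → 0ℚ ≤ ∑ xs f
∑-nonNeg xs e = ≤-trans (≤-reflexive (sym (∑-0 xs))) (∑-mono-≤ xs e)

∏ : ∀ {n} → Vec ℚ n → ℚ
∏ = V.foldr _ _*_ 1ℚ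

module _ {A : Set} (xs : List A) where

  ∑-allVecsOf-suc : ∀ n (f : Vec A (suc n) → ℚ) →
    ∑ (allVecsOf xs (suc n)) f ≡ ∑ xs (λ a → ∑ (allVecsOf xs n) (λ v → f (a ∷ v)))
  ∑-allVecsOf-suc n f = trans (∑-concatMap _ xs f) (∑-cong xs (λ a → ∑-map (a ∷_) (allVecsOf xs n) f))

  ∑-allVecsOf-∏ : ∀ n (f : A → ℚ) → ∑ (allVecsOf xs n) (λ v → ∏ (V.map f v)) ≡ ∑ xs f ^ℚ n
  ∑-allVecsOf-∏ zero f = +-identityʳ _
  ∑-allVecsOf-∏ (suc n) f = begin
    ∑ (allVecsOf xs (suc n)) (λ v → ∏ (V.map f v))
      ≡⟨ ∑-allVecsOf-suc n _ ⟩
    ∑ xs (λ a → ∑ (allVecsOf xs n) (λ v → f a * ∏ (V.map f v)))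
      ≡⟨ ∑-cong xs (λ a → trans (∑-*ˡ (allVecsOf xs n) (f a) _) (cong (f a *_) (∑-allVecsOf-∏ n f))) ⟩
    ∑ xs (λ a → f a * ∑ xs f ^ℚ n)
      ≡⟨ ∑-*ʳ xs _ f ⟩
    ∑ xs f * ∑ xs f ^ℚ n ∎
    where open ≡-Reasoning

  count-allVecsOf : ∀ n → count (allVecsOf xs n) ≡ count xs ^ℚ n
  count-allVecsOf zero = refl
  count-allVecsOf (suc n) = trans (∑-allVecsOf-suc n _)
    (trans (∑-cong xs (λ _ → trans (count-allVecsOf n) (sym (*-identityˡ _)))) (∑-*ʳ xs _ (λ _ → 1ℚ)))

-- Expectations

+suc/1≡1++/1 : ∀ n → + suc n / 1 ≡ 1ℚ + + n / 1
+suc/1≡1++/1 n rewrite normalize-coprime {n} {0} (coprime-sym (1-coprimeTo n))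
                     | ℕ.*-identityʳ n | ℤ.+◃n≡+n n = refl

1/suc*suc≡1 : ∀ n → + 1 / suc n * (+ suc n / 1) ≡ 1ℚ
1/suc*suc≡1 n rewrite normalize-coprime {suc n} {0} (coprime-sym (1-coprimeTo (suc n)))
                    | normalize-coprime {1} {n} (1-coprimeTo (suc n))
  = *-inverseˡ (mkℚ (+ suc n) 0 (coprime-sym (1-coprimeTo (suc n))))

count≡length : (xs : List A) → count xs ≡ + length xs / 1
count≡length [] = refl
count≡length (x ∷ xs) = trans (cong (_+_ 1ℚ) (count≡length xs)) (sym (+suc/1≡1++/1 (length xs)))

𝔼*count≡∑ : (xs : List A) (f : A → ℚ) → 0ℚ < count xs → 𝔼 xs f * count xs ≡ ∑ xs f
𝔼*count≡∑ [] f 0<0 = contradiction 0<0 (<-irrefl refl)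
𝔼*count≡∑ xs@(_ ∷ ys) f _ = begin
  ∑ xs f * (+ 1 / suc n) * count xs        ≡⟨ cong (∑ xs f * (+ 1 / suc n) *_) (count≡length xs) ⟩
  ∑ xs f * (+ 1 / suc n) * (+ suc n / 1)   ≡⟨ *-assoc (∑ xs f) _ _ ⟩
  ∑ xs f * (+ 1 / suc n * (+ suc n / 1))   ≡⟨ cong (∑ xs f *_) (1/suc*suc≡1 n) ⟩
  ∑ xs f * 1ℚ                              ≡⟨ *-identityʳ _ ⟩
  ∑ xs f                                   ∎
  where open ≡-Reasoning
        n = length ys

∣𝔼∣*count≡∑ : (xs : List A) (f : A → ℚ) → 0ℚ < count xs → 0ℚ ≤ ∑ xs f →
             ∣ 𝔼 xs f ∣ * count xs ≡ ∑ xs f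
∣𝔼∣*count≡∑ xs f count>0 ∑≥0 = trans (cong (_* count xs) (0≤p⇒∣p∣≡p 𝔼≥0)) (𝔼*count≡∑ xs f count>0)
  where
  𝔼≥0 : 0ℚ ≤ 𝔼 xs f
  𝔼≥0 = *-cancelʳ-≤-pos (count xs) {{positive count>0}}
    (≤-trans (≤-reflexive (*-zeroˡ (count xs))) (≤-trans ∑≥0 (≤-reflexive (sym (𝔼*count≡∑ xs f count>0)))))

*-nonNeg : ∀ {p q} → 0ℚ ≤ p → 0ℚ ≤ q → 0ℚ ≤ p * q
*-nonNeg {p} {q} p≥0 q≥0 = nonNegative⁻¹ _ {{nonNeg*nonNeg⇒nonNeg p {{nonNegative p≥0}} q {{nonNegative q≥0}}}}

*-pos : ∀ {p q} → 0ℚ < p → 0ℚ < q → 0ℚ < p * q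
*-pos {p} {q} p>0 q>0 = positive⁻¹ _ {{pos*pos⇒pos p {{positive p>0}} q {{positive q>0}}}}

^ℚ-nonNeg : ∀ {p} n → 0ℚ ≤ p → 0ℚ ≤ p ^ℚ n
^ℚ-nonNeg zero p≥0 = nonNegative⁻¹ 1ℚ
^ℚ-nonNeg (suc n) p≥0 = *-nonNeg p≥0 (^ℚ-nonNeg n p≥0)

^ℚ-pos : ∀ {p} n → 0ℚ < p → 0ℚ < p ^ℚ n
^ℚ-pos zero p>0 = positive⁻¹ 1ℚ
^ℚ-pos (suc n) p>0 = *-pos p>0 (^ℚ-pos n p>0)

^ℚ-distribʳ-* : ∀ p q n → (p * q) ^ℚ n ≡ p ^ℚ n * q ^ℚ n
^ℚ-distribʳ-* p q zero = refl
^ℚ-distribʳ-* p q (suc n) = trans (cong (p * q *_) (^ℚ-distribʳ-* p q n))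
  (solve 4 (λ a b x y → (a :* b) :* (x :* y) := (a :* x) :* (b :* y)) refl p q (p ^ℚ n) (q ^ℚ n))

1^ℚn≡1 : ∀ n → 1ℚ ^ℚ n ≡ 1ℚ
1^ℚn≡1 zero = refl
1^ℚn≡1 (suc n) = trans (*-identityˡ _) (1^ℚn≡1 n)

γ : ℕ → ℚ
γ d = 1ℚ - (+ 2 / 1) * (½ ^ℚ d)

½^n≤1 : ∀ n → ½ ^ℚ n ≤ 1ℚ
½^n≤1 zero = ≤-refl
½^n≤1 (suc n) = ≤-trans (*-monoˡ-≤-nonNeg ½ (½^n≤1 n)) (≤ᵇ⇒≤ _)

γ-nonNeg : ∀ d → d ≥ 1 → 0ℚ ≤ γ d
γ-nonNeg (suc d) _ = ≤-trans (≤-reflexive (sym (+-inverseʳ 2⁻ᵈ))) (+-mono-≤ 2⁻ᵈ≤1 (≤-refl { - 2⁻ᵈ}))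
  where
  2⁻ᵈ = (+ 2 / 1) * (½ ^ℚ suc d)
  2⁻ᵈ≤1 : 2⁻ᵈ ≤ 1ℚ
  2⁻ᵈ≤1 = ≤-trans (*-monoˡ-≤-nonNeg (+ 2 / 1) (*-monoˡ-≤-nonNeg ½ (½^n≤1 d))) (≤ᵇ⇒≤ _)

-- Signs and indicators of F₂

ind : Bool → ℚ
ind true = 1ℚ
ind false = 0ℚ

sign≡1-2ind : ∀ b → sign b ≡ 1ℚ - (+ 2 / 1) * ind b
sign≡1-2ind true = refl
sign≡1-2ind false = refl

ind≡½[1-sign] : ∀ b → ind b ≡ ½ * (1ℚ - sign b)
ind≡½[1-sign] true = refl
ind≡½[1-sign] false = refl

sign-xor : ∀ a b → sign (a xor b) ≡ sign a * sign b
sign-xor true true = refl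
sign-xor true false = refl
sign-xor false true = refl
sign-xor false false = refl

sign-not : ∀ b → sign (not b) ≡ - sign b
sign-not true = refl
sign-not false = refl

ind-∧ : ∀ a b → ind (a ∧ b) ≡ ind a * ind b
ind-∧ true b = sym (*-identityˡ _)
ind-∧ false b = sym (*-zeroˡ (ind b))

ind-nonNeg : ∀ b → 0ℚ ≤ ind b
ind-nonNeg true = ≤ᵇ⇒≤ _
ind-nonNeg false = ≤-refl

ind-not-∧ : ∀ a b → ind (not (a ∧ b)) ≤ ind (not a) + ind (not b)
ind-not-∧ true true = ≤ᵇ⇒≤ _
ind-not-∧ true false = ≤ᵇ⇒≤ _
ind-not-∧ false true = ≤ᵇ⇒≤ _
ind-not-∧ false false = ≤ᵇ⇒≤ _

sign-foldr-xor : ∀ {t} (g : A → Bool) (u : Vec A t) →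
  sign (V.foldr _ _xor_ false (V.map g u)) ≡ ∏ (V.map (sign ∘ g) u)
sign-foldr-xor g [] = refl
sign-foldr-xor g (a ∷ u) = trans (sign-xor (g a) _) (cong (sign (g a) *_) (sign-foldr-xor g u))

-- Linear algebra over F₂

module _ {k : ℕ} where

  infixl 6 _⊕_
  infixl 7 _·_

  0̂ : F₂^ k
  0̂ = V.replicate k false

  _⊕_ : F₂^ k → F₂^ k → F₂^ k
  _⊕_ = zipWith _xor_

  _·_ : F₂^ k → Bool → F₂^ k
  a · c = V.map (_∧ c) a

  nonzero : F₂^ k → Bool
  nonzero = V.foldr _ _∨_ false

⟨⟩-comm : ∀ {k} (x y : F₂^ k) → ⟨ x , y ⟩ ≡ ⟨ y , x ⟩
⟨⟩-comm [] [] = refl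
⟨⟩-comm (x ∷ xs) (y ∷ ys) = cong₂ _xor_ (∧-comm x y) (⟨⟩-comm xs ys)

⟨x,0̂⟩≡false : ∀ {k} (x : F₂^ k) → ⟨ x , 0̂ ⟩ ≡ false
⟨x,0̂⟩≡false [] = refl
⟨x,0̂⟩≡false (true ∷ x) = ⟨x,0̂⟩≡false x
⟨x,0̂⟩≡false (false ∷ x) = ⟨x,0̂⟩≡false x

⟨x,a⊕b⟩ : ∀ {k} (x a b : F₂^ k) → ⟨ x , a ⊕ b ⟩ ≡ ⟨ x , a ⟩ xor ⟨ x , b ⟩
⟨x,a⊕b⟩ [] [] [] = refl
⟨x,a⊕b⟩ (x ∷ xs) (a ∷ as) (b ∷ bs) =
  trans (cong₂ _xor_ (∧-distribˡ-xor x a b) (⟨x,a⊕b⟩ xs as bs)) (interchange (x ∧ a) (x ∧ b) ⟨ xs , as ⟩ ⟨ xs , bs ⟩)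

⟨x,a·c⟩ : ∀ {k} (x a : F₂^ k) c → ⟨ x , a · c ⟩ ≡ ⟨ x , a ⟩ ∧ c
⟨x,a·c⟩ [] [] c = refl
⟨x,a·c⟩ (x ∷ xs) (a ∷ as) c = trans (cong₂ _xor_ (sym (∧-assoc x a c)) (⟨x,a·c⟩ xs as c))
  (sym (∧-distribʳ-xor c (x ∧ a) ⟨ xs , as ⟩))

monomial : ∀ {k d} → Vec (F₂^ k) d → Vec (F₂^ k) d → Bool
monomial x r = V.foldr _ _∧_ true (zipWith ⟨_,_⟩ x r)

allNonzero : ∀ {k d} → Vec (F₂^ k) d → Bool
allNonzero [] = true
allNonzero (v ∷ x) = nonzero v ∧ allNonzero x

coefficient : ∀ {k d t} → Vec (Vec (F₂^ k) (suc d)) t → Vec (F₂^ k) d → F₂^ k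
coefficient [] x' = 0̂
coefficient ((r₁ ∷ r') ∷ u) x' = r₁ · monomial x' r' ⊕ coefficient u x'

form-linear : ∀ {k d t} (u : Vec (Vec (F₂^ k) (suc d)) t) x₁ x' →
  form u (x₁ ∷ x') ≡ ⟨ x₁ , coefficient u x' ⟩
form-linear [] x₁ x' = sym (⟨x,0̂⟩≡false x₁)
form-linear ((r₁ ∷ r') ∷ u) x₁ x' = begin
  (⟨ x₁ , r₁ ⟩ ∧ monomial x' r') xor form u (x₁ ∷ x')
    ≡⟨ cong₂ _xor_ (sym (⟨x,a·c⟩ x₁ r₁ _)) (form-linear u x₁ x') ⟩
  ⟨ x₁ , r₁ · monomial x' r' ⟩ xor ⟨ x₁ , coefficient u x' ⟩
    ≡⟨ sym (⟨x,a⊕b⟩ x₁ _ _) ⟩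
  ⟨ x₁ , coefficient ((r₁ ∷ r') ∷ u) x' ⟩ ∎
  where open ≡-Reasoning

-- Character sums over F₂^k

card : ℕ → ℚ
card k = count (allF₂^ k)

card-suc : ∀ k → card (suc k) ≡ card k + (card k + 0ℚ)
card-suc k = ∑-allVecsOf-suc (false ∷ true ∷ []) k (λ _ → 1ℚ)

card-pos : ∀ k → 0ℚ < card k
card-pos zero = positive⁻¹ 1ℚ
card-pos (suc k) = subst (0ℚ <_) (sym (card-suc k))
  (+-mono-< (card-pos k) (subst (0ℚ <_) (sym (+-identityʳ (card k))) (card-pos k)))

card*½^k≡1 : ∀ k → card k * ½ ^ℚ k ≡ 1ℚ
card*½^k≡1 zero = refl
card*½^k≡1 (suc k) = begin
  card (suc k) * (½ * ½ ^ℚ k)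
    ≡⟨ cong (_* (½ * ½ ^ℚ k)) (card-suc k) ⟩
  (card k + (card k + 0ℚ)) * (½ * ½ ^ℚ k)
    ≡⟨ solve 3 (λ N h e → (N :+ (N :+ con 0ℚ)) :* (h :* e) := (N :* e) :* (h :+ h)) refl (card k) ½ (½ ^ℚ k) ⟩
  card k * ½ ^ℚ k * (½ + ½)
    ≡⟨ cong (_* 1ℚ) (card*½^k≡1 k) ⟩
  1ℚ ∎
  where open ≡-Reasoning

∑-sign-⟨⟩ : ∀ {k} (v : F₂^ k) → ∑ (allF₂^ k) (λ x → sign ⟨ x , v ⟩) ≡ ind (not (nonzero v)) * card k
∑-sign-⟨⟩ [] = refl
∑-sign-⟨⟩ {suc k} (false ∷ v) = begin
  ∑ (allF₂^ (suc k)) (λ x → sign ⟨ x , false ∷ v ⟩)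
    ≡⟨ ∑-allVecsOf-suc (false ∷ true ∷ []) k _ ⟩
  S + (S + 0ℚ)
    ≡⟨ cong (λ z → z + (z + 0ℚ)) (∑-sign-⟨⟩ v) ⟩
  i * card k + (i * card k + 0ℚ)
    ≡⟨ solve 2 (λ i N → i :* N :+ (i :* N :+ con 0ℚ) := i :* (N :+ (N :+ con 0ℚ))) refl i (card k) ⟩
  i * (card k + (card k + 0ℚ))
    ≡⟨ cong (i *_) (sym (card-suc k)) ⟩
  i * card (suc k) ∎
  where open ≡-Reasoning
        S = ∑ (allF₂^ k) (λ x → sign ⟨ x , v ⟩)
        i = ind (not (nonzero v))
∑-sign-⟨⟩ {suc k} (true ∷ v) = begin
  ∑ (allF₂^ (suc k)) (λ x → sign ⟨ x , true ∷ v ⟩)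
    ≡⟨ ∑-allVecsOf-suc (false ∷ true ∷ []) k _ ⟩
  S + (∑ (allF₂^ k) (λ x → sign (not ⟨ x , v ⟩)) + 0ℚ)
    ≡⟨ cong (λ z → S + (z + 0ℚ)) (trans (∑-cong (allF₂^ k) (sign-not ∘ ⟨_, v ⟩)) (∑-neg (allF₂^ k) _)) ⟩
  S + (- S + 0ℚ)
    ≡⟨ solve 2 (λ S N → S :+ (:- S :+ con 0ℚ) := con 0ℚ :* N) refl S (card (suc k)) ⟩
  0ℚ * card (suc k) ∎
  where open ≡-Reasoning
        S = ∑ (allF₂^ k) (λ x → sign ⟨ x , v ⟩)

∑-ind-⟨⟩ : ∀ {k} (v : F₂^ k) → ∑ (allF₂^ k) (λ r → ind ⟨ v , r ⟩) ≡ ind (nonzero v) * (card k * ½)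
∑-ind-⟨⟩ {k} v = begin
  ∑ F (λ r → ind ⟨ v , r ⟩)
    ≡⟨ ∑-cong F (λ r → trans (ind≡½[1-sign] ⟨ v , r ⟩) (cong (λ b → ½ * (1ℚ - sign b)) (⟨⟩-comm v r))) ⟩
  ∑ F (λ r → ½ * (1ℚ - sign ⟨ r , v ⟩))
    ≡⟨ ∑-*ˡ F ½ _ ⟩
  ½ * ∑ F (λ r → 1ℚ - sign ⟨ r , v ⟩)
    ≡⟨ cong (½ *_) (trans (∑-+ F _ _) (cong (_+_ (card k)) (∑-neg F _))) ⟩
  ½ * (card k - ∑ F (λ r → sign ⟨ r , v ⟩))
    ≡⟨ cong (λ z → ½ * (card k - z)) (∑-sign-⟨⟩ v) ⟩
  ½ * (card k - ind (not (nonzero v)) * card k)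
    ≡⟨ ½[N-ind¬b*N] (nonzero v) (card k) ⟩
  ind (nonzero v) * (card k * ½) ∎
  where
  open ≡-Reasoning
  F = allF₂^ k
  ½[N-ind¬b*N] : ∀ b N → ½ * (N - ind (not b) * N) ≡ ind b * (N * ½)
  ½[N-ind¬b*N] true N = solve 2 (λ h N → h :* (N :- con 0ℚ :* N) := con 1ℚ :* (N :* h)) refl ½ N
  ½[N-ind¬b*N] false N = solve 2 (λ h N → h :* (N :- con 1ℚ :* N) := con 0ℚ :* (N :* h)) refl ½ N

∑-ind-monomial : ∀ {k d} (x : Vec (F₂^ k) d) →
  ∑ (allVecsOf (allF₂^ k) d) (λ r → ind (monomial x r)) ≡ ind (allNonzero x) * (card k * ½) ^ℚ d
∑-ind-monomial [] = refl
∑-ind-monomial {k} {suc d} (v ∷ x) = begin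
  ∑ (allVecsOf F (suc d)) (λ r → ind (monomial (v ∷ x) r))
    ≡⟨ ∑-allVecsOf-suc F d _ ⟩
  ∑ F (λ a → ∑ R (λ r → ind (⟨ v , a ⟩ ∧ monomial x r)))
    ≡⟨ ∑-cong F (λ a → trans (∑-cong R (λ r → ind-∧ ⟨ v , a ⟩ _)) (∑-*ˡ R (ind ⟨ v , a ⟩) _)) ⟩
  ∑ F (λ a → ind ⟨ v , a ⟩ * ∑ R (λ r → ind (monomial x r)))
    ≡⟨ ∑-*ʳ F _ _ ⟩
  ∑ F (λ a → ind ⟨ v , a ⟩) * ∑ R (λ r → ind (monomial x r))
    ≡⟨ cong₂ _*_ (∑-ind-⟨⟩ v) (∑-ind-monomial x) ⟩
  ind (nonzero v) * c * (ind (allNonzero x) * c ^ℚ d)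
    ≡⟨ solve 4 (λ a b c e → a :* c :* (b :* e) := a :* b :* (c :* e)) refl (ind (nonzero v)) (ind (allNonzero x)) c (c ^ℚ d) ⟩
  ind (nonzero v) * ind (allNonzero x) * c ^ℚ suc d
    ≡⟨ cong (_* c ^ℚ suc d) (sym (ind-∧ (nonzero v) (allNonzero x))) ⟩
  ind (allNonzero (v ∷ x)) * c ^ℚ suc d ∎
  where open ≡-Reasoning
        F = allF₂^ k
        R = allVecsOf F d
        c = card k * ½

monomialSum : ∀ {k d} → Vec (F₂^ k) d → ℚ
monomialSum {k} {d} x = ∑ (allVecsOf (allF₂^ k) d) (λ r → sign (monomial x r))

monomialSum≡ : ∀ {k d} (x : Vec (F₂^ k) d) →
  monomialSum x ≡ count (allVecsOf (allF₂^ k) d) * (if allNonzero x then γ d else 1ℚ)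
monomialSum≡ {k} {d} x = begin
  ∑ R (λ r → sign (monomial x r))
    ≡⟨ ∑-cong R (sign≡1-2ind ∘ monomial x) ⟩
  ∑ R (λ r → 1ℚ - (+ 2 / 1) * ind (monomial x r))
    ≡⟨ trans (∑-+ R (λ _ → 1ℚ) _) (cong (_+_ (count R)) (trans (∑-neg R _) (cong -_ (∑-*ˡ R (+ 2 / 1) (ind ∘ monomial x))))) ⟩
  count R - (+ 2 / 1) * ∑ R (λ r → ind (monomial x r))
    ≡⟨ cong (λ z → count R - (+ 2 / 1) * z) (∑-ind-monomial x) ⟩
  count R - (+ 2 / 1) * (ind (allNonzero x) * (card k * ½) ^ℚ d)
    ≡⟨ cong (λ z → count R - (+ 2 / 1) * (ind (allNonzero x) * z))
         (trans (^ℚ-distribʳ-* (card k) ½ d) (cong (_* ½ ^ℚ d) (sym (count-allVecsOf (allF₂^ k) d)))) ⟩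
  count R - (+ 2 / 1) * (ind (allNonzero x) * (count R * ½ ^ℚ d))
    ≡⟨ P-2ind*P*h (allNonzero x) (count R) (½ ^ℚ d) ⟩
  count R * (if allNonzero x then γ d else 1ℚ) ∎
  where
  open ≡-Reasoning
  R = allVecsOf (allF₂^ k) d
  P-2ind*P*h : ∀ b P h → P - (+ 2 / 1) * (ind b * (P * h)) ≡ P * (if b then 1ℚ - (+ 2 / 1) * h else 1ℚ)
  P-2ind*P*h true P h = solve 2 (λ P h → P :- con (+ 2 / 1) :* (con 1ℚ :* (P :* h)) := P :* (con 1ℚ :- con (+ 2 / 1) :* h)) refl P h
  P-2ind*P*h false P h = solve 2 (λ P h → P :- con (+ 2 / 1) :* (con 0ℚ :* (P :* h)) := P :* con 1ℚ) refl P h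

∑-sign-form : ∀ k d t (x : Vec (F₂^ k) d) → ∑ (allArrays k d t) (λ u → sign (form u x)) ≡ monomialSum x ^ℚ t
∑-sign-form k d t x = trans (∑-cong (allArrays k d t) (sign-foldr-xor (monomial x)))
  (∑-allVecsOf-∏ (allVecsOf (allF₂^ k) d) t (sign ∘ monomial x))

∑-sign-form-nonNeg : ∀ {k d t} (u : Vec (Vec (F₂^ k) (suc d)) t) →
  0ℚ ≤ ∑ (allVecsOf (allF₂^ k) (suc d)) (λ x → sign (form u x))
∑-sign-form-nonNeg {k} {d} u = subst (0ℚ ≤_) (sym ∑≡) (∑-nonNeg X' (λ x' → character-nonNeg (coefficient u x')))
  where
  F = allF₂^ k
  X' = allVecsOf F d
  character-nonNeg : ∀ v → 0ℚ ≤ ∑ F (λ x₁ → sign ⟨ x₁ , v ⟩)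
  character-nonNeg v = subst (0ℚ ≤_) (sym (∑-sign-⟨⟩ v)) (*-nonNeg (ind-nonNeg (not (nonzero v))) (<⇒≤ (card-pos k)))
  ∑≡ : ∑ (allVecsOf F (suc d)) (λ x → sign (form u x)) ≡ ∑ X' (λ x' → ∑ F (λ x₁ → sign ⟨ x₁ , coefficient u x' ⟩))
  ∑≡ = trans (∑-allVecsOf-suc F d _) (trans (∑-comm F X' _)
         (∑-cong X' (λ x' → ∑-cong F (λ x₁ → cong sign (form-linear u x₁ x')))))

if^ℚ≤ : ∀ b g t → 0ℚ ≤ g → (if b then g else 1ℚ) ^ℚ t ≤ g ^ℚ t + ind (not b)
if^ℚ≤ true g t g≥0 = ≤-reflexive (sym (+-identityʳ _))
if^ℚ≤ false g t g≥0 = ≤-trans (≤-reflexive (trans (1^ℚn≡1 t) (sym (+-identityˡ 1ℚ))))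
  (+-mono-≤ (^ℚ-nonNeg t g≥0) ≤-refl)

-- Points with a zero coordinate

#withZero : ℕ → ℕ → ℚ
#withZero k d = ∑ (allVecsOf (allF₂^ k) d) (λ x → ind (not (allNonzero x)))

∑-ind-zero : ∀ k → ∑ (allF₂^ k) (λ a → ind (not (nonzero a))) ≡ 1ℚ
∑-ind-zero zero = refl
∑-ind-zero (suc k) = trans (∑-allVecsOf-suc (false ∷ true ∷ []) k _)
  (cong₂ (λ a b → a + (b + 0ℚ)) (∑-ind-zero k) (∑-0 (allF₂^ k)))

#withZero-suc : ∀ k d → #withZero k (suc d) ≤ count (allVecsOf (allF₂^ k) d) + #withZero k d * card k
#withZero-suc k d = begin
  #withZero k (suc d)
    ≡⟨ ∑-allVecsOf-suc F d _ ⟩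
  ∑ F (λ a → ∑ X (λ x → ind (not (nonzero a ∧ allNonzero x))))
    ≤⟨ ∑-mono-≤ F (λ a → ∑-mono-≤ X (λ x → ind-not-∧ (nonzero a) (allNonzero x))) ⟩
  ∑ F (λ a → ∑ X (λ x → ind (not (nonzero a)) + ind (not (allNonzero x))))
    ≡⟨ ∑-cong F (λ a → trans (∑-+ X (λ _ → ind (not (nonzero a))) _) (cong (_+ #withZero k d) (∑-const X (ind (not (nonzero a)))))) ⟩
  ∑ F (λ a → ind (not (nonzero a)) * count X + #withZero k d)
    ≡⟨ ∑-+ F _ _ ⟩
  ∑ F (λ a → ind (not (nonzero a)) * count X) + ∑ F (λ _ → #withZero k d)
    ≡⟨ cong₂ _+_ (trans (∑-*ʳ F (count X) (ind ∘ not ∘ nonzero)) (trans (cong (_* count X) (∑-ind-zero k)) (*-identityˡ (count X)))) (∑-const F (#withZero k d)) ⟩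
  count X + #withZero k d * card k ∎
  where open ≤-Reasoning
        F = allF₂^ k
        X = allVecsOf F d

-- The union bound Pr[some x_j = 0] ≤ d 2^-k, multiplied out.
#withZero*card≤ : ∀ k d → #withZero k d * card k ≤ (+ d / 1) * count (allVecsOf (allF₂^ k) d)
#withZero*card≤ k zero = ≤-reflexive (*-zeroˡ (card k))
#withZero*card≤ k (suc d) = begin
  #withZero k (suc d) * card k
    ≤⟨ *-monoʳ-≤-nonNeg (card k) {{nonNegative (<⇒≤ (card-pos k))}} (#withZero-suc k d) ⟩
  (count X + #withZero k d * card k) * card k
    ≤⟨ *-monoʳ-≤-nonNeg (card k) {{nonNegative (<⇒≤ (card-pos k))}} (+-monoʳ-≤ (count X) (#withZero*card≤ k d)) ⟩
  (count X + (+ d / 1) * count X) * card k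
    ≡⟨ solve 3 (λ P n N → (P :+ n :* P) :* N := (con 1ℚ :+ n) :* (P :* N)) refl (count X) (+ d / 1) (card k) ⟩
  (1ℚ + + d / 1) * (count X * card k)
    ≡⟨ cong₂ _*_ (sym (+suc/1≡1++/1 d)) (trans (*-comm (count X) (card k)) (trans (cong (card k *_) (count-allVecsOf F d)) (sym (count-allVecsOf F (suc d))))) ⟩
  (+ suc d / 1) * count (allVecsOf F (suc d)) ∎
  where open ≤-Reasoning
        F = allF₂^ k
        X = allVecsOf F d

#withZero≤ : ∀ k d → #withZero k d ≤ (+ d / 1) * count (allVecsOf (allF₂^ k) d) * ½ ^ℚ k
#withZero≤ k d = begin
  #withZero k d                            ≡⟨ sym (trans (*-assoc (#withZero k d) (card k) (½ ^ℚ k)) (trans (cong (#withZero k d *_) (card*½^k≡1 k)) (*-identityʳ (#withZero k d)))) ⟩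
  #withZero k d * card k * ½ ^ℚ k          ≤⟨ *-monoʳ-≤-nonNeg (½ ^ℚ k) {{nonNegative (^ℚ-nonNeg k (≤ᵇ⇒≤ _))}} (#withZero*card≤ k d) ⟩
  (+ d / 1) * count (allVecsOf (allF₂^ k) d) * ½ ^ℚ k ∎
  where open ≤-Reasoning

∑-monomialSum^ℚ≤ : ∀ k d t → d ≥ 1 →
  ∑ (allVecsOf (allF₂^ k) d) (λ x → monomialSum x ^ℚ t)
    ≤ count (allVecsOf (allF₂^ k) d) ^ℚ t * (γ d ^ℚ t * count (allVecsOf (allF₂^ k) d) + #withZero k d)
∑-monomialSum^ℚ≤ k d t d≥1 = begin
  ∑ X (λ x → monomialSum x ^ℚ t)
    ≡⟨ ∑-cong X (λ x → trans (cong (_^ℚ t) (monomialSum≡ x)) (^ℚ-distribʳ-* P _ t)) ⟩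
  ∑ X (λ x → P ^ℚ t * (if allNonzero x then γ d else 1ℚ) ^ℚ t)
    ≤⟨ ∑-mono-≤ X (λ x → *-monoˡ-≤-nonNeg (P ^ℚ t) {{nonNegative P^t≥0}} (if^ℚ≤ (allNonzero x) (γ d) t (γ-nonNeg d d≥1))) ⟩
  ∑ X (λ x → P ^ℚ t * (γ d ^ℚ t + ind (not (allNonzero x))))
    ≡⟨ trans (∑-*ˡ X (P ^ℚ t) _) (cong (P ^ℚ t *_) (trans (∑-+ X (λ _ → γ d ^ℚ t) _) (cong (_+ #withZero k d) (∑-const X (γ d ^ℚ t))))) ⟩
  P ^ℚ t * (γ d ^ℚ t * P + #withZero k d) ∎
  where open ≤-Reasoning
        X = allVecsOf (allF₂^ k) d
        P = count X
        P^t≥0 = ^ℚ-nonNeg t (subst (0ℚ ≤_) (sym (count-allVecsOf (allF₂^ k) d)) (^ℚ-nonNeg d (<⇒≤ (card-pos k))))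

lemma4p3 : (k d t : ℕ) → d ≥ 1 →
    𝔼 (allArrays k d t) (λ u → bias (form u))
      ≤ (+ d / 1) * (½ ^ℚ k) + (1ℚ - (+ 2 / 1) * (½ ^ℚ d)) ^ℚ t
lemma4p3 k d@(suc _) t d≥1 = *-cancelʳ-≤-pos (M * P) {{positive (*-pos M>0 P>0)}} (begin
  𝔼 U bias-u * (M * P)
    ≡⟨ trans (sym (*-assoc (𝔼 U bias-u) M P)) (cong (λ z → 𝔼 U bias-u * z * P) (sym (count-allVecsOf X t))) ⟩
  𝔼 U bias-u * count U * P
    ≡⟨ trans (cong (_* P) (𝔼*count≡∑ U bias-u U>0)) (sym (∑-*ʳ U P bias-u)) ⟩
  ∑ U (λ u → bias-u u * P)
    ≡⟨ ∑-cong U (λ u → ∣𝔼∣*count≡∑ X _ P>0 (∑-sign-form-nonNeg u)) ⟩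
  ∑ U (λ u → ∑ X (λ x → sign (form u x)))
    ≡⟨ trans (∑-comm U X _) (∑-cong X (∑-sign-form k d t)) ⟩
  ∑ X (λ x → monomialSum x ^ℚ t)
    ≤⟨ ∑-monomialSum^ℚ≤ k d t d≥1 ⟩
  M * (γ d ^ℚ t * P + #withZero k d)
    ≤⟨ *-monoˡ-≤-nonNeg M {{nonNegative (<⇒≤ M>0)}} (+-monoʳ-≤ (γ d ^ℚ t * P) (#withZero≤ k d)) ⟩
  M * (γ d ^ℚ t * P + (+ d / 1) * P * ½ ^ℚ k)
    ≡⟨ solve 5 (λ M g P n h → M :* (g :* P :+ n :* P :* h) := (n :* h :+ g) :* (M :* P)) refl M (γ d ^ℚ t) P (+ d / 1) (½ ^ℚ k) ⟩
  ((+ d / 1) * ½ ^ℚ k + γ d ^ℚ t) * (M * P) ∎)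
  where
  open ≤-Reasoning
  X = allVecsOf (allF₂^ k) d
  U = allArrays k d t
  P = count X
  M = P ^ℚ t
  bias-u : Vec (Vec (F₂^ k) d) t → ℚ
  bias-u u = bias (form u)
  P>0 : 0ℚ < P
  P>0 = subst (0ℚ <_) (sym (count-allVecsOf (allF₂^ k) d)) (^ℚ-pos d (card-pos k))
  M>0 : 0ℚ < M
  M>0 = ^ℚ-pos t P>0
  U>0 : 0ℚ < count U
  U>0 = subst (0ℚ <_) (sym (count-allVecsOf X t)) M>0
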